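{- If $G$ is a connected graph and $uwv$ is a path in $G$ (so $uw,wv\in E(G)$ with $u,w,v$ distinct), then $b_{dR}(G)\leq \deg_G(u)+\deg_G(v)-1$.
   Context: All graphs are finite, simple and undirected; $\deg_G(v)$ is the degree of $v$. For a graph $G=(V,E)$, a double Roman dominating function (DRDF) is a function $f:V\to\{0,1,2,3\}$ such that every vertex $v$ with $f(v)=0$ has at least two neighbors $u$ with $f(u)=2$ or at least one neighbor $w$ with $f(w)=3$, and every vertex $v$ with $f(v)=1$ has at least one neighbor $w$ with $f(w)\geq 2$. The weight of $f$ is $\sum_{u\in V}f(u)$, and $\gamma_{dR}(G)$ is the minimum weight of a DRDF on $G$. The double Roman bondage number $b_{dR}(G)$ is the minimum cardinality of an edge set $B\subseteq E(G)$ such that $\gamma_{dR}(G-B)>\gamma_{dR}(G)$. -}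

module Defs where

open import Data.Nat using (ℕ; _+_; _≤_; _<_; _≥_)
open import Data.Bool using (Bool; true; false; if_then_else_; _∧_; not; _∨_)
open import Data.Fin using (Fin)
open import Data.Fin.Properties using (_≟_)
open import Data.List using (List; []; _∷_; map; length)
open import Data.Nat.ListAction using (sum)
open import Data.Bool.ListAction using (any)
open import Data.List.Relation.Unary.All using (All)
open import Data.Product using (Σ; _×_; _,_; ∃; ∃-syntax)
open import Data.Sum using (_⊎_)
open import Relation.Binary.PropositionalEquality using (_≡_; _≢_)
open import Relation.Nullary.Decidable using (⌊_⌋)
open import Relation.Binary.Construct.Closure.ReflexiveTransitive using (Star)
open import Data.List.Base using (allFin)

record Graph (n : ℕ) : Set where
  field
    adj   : Fin n → Fin n → Bool
    sym   : ∀ i j → adj i j ≡ adj j i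
    irref : ∀ i → adj i i ≡ false
open Graph public

Adj : ∀ {n} → Graph n → Fin n → Fin n → Set
Adj G i j = adj G i j ≡ true

deg : ∀ {n} → Graph n → Fin n → ℕ
deg {n} G v = sum (map (λ j → if adj G v j then 1 else 0) (allFin n))

Connected : ∀ {n} → Graph n → Set
Connected {n} G = ∀ (i j : Fin n) → Star (Adj G) i j

-- An edge set is given as a list of vertex pairs (each representing the
-- unordered edge {a,b}); its cardinality is at most the list length.
EdgeList : ℕ → Set
EdgeList n = List (Fin n × Fin n)

inEdges : ∀ {n} → EdgeList n → Fin n → Fin n → Bool
inEdges B i j = any (λ { (a , b) → (⌊ a ≟ i ⌋ ∧ ⌊ b ≟ j ⌋) ∨ (⌊ a ≟ j ⌋ ∧ ⌊ b ≟ i ⌋) }) B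

removeEdges : ∀ {n} → Graph n → EdgeList n → Graph n
removeEdges G B = record
  { adj   = λ i j → adj G i j ∧ not (inEdges B i j)
  ; sym   = λ i j → lemma i j
  ; irref = λ i → irr i
  }
  where
  open import Relation.Binary.PropositionalEquality using (cong₂; cong; refl)
  open import Data.Bool.Properties using (∨-comm)
  open import Data.List.Properties using ()
  swapP : ∀ {n} (B : EdgeList n) i j → inEdges B i j ≡ inEdges B j i
  swapP [] i j = refl
  swapP ((a , b) ∷ B) i j =
    cong₂ _∨_ (∨-comm (⌊ a ≟ i ⌋ ∧ ⌊ b ≟ j ⌋) (⌊ a ≟ j ⌋ ∧ ⌊ b ≟ i ⌋)) (swapP B i j)
  lemma : ∀ i j → (adj G i j ∧ not (inEdges B i j)) ≡ (adj G j i ∧ not (inEdges B j i))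
  lemma i j = cong₂ _∧_ (Graph.sym G i j) (cong not (swapP B i j))
  irr : ∀ i → (adj G i i ∧ not (inEdges B i i)) ≡ false
  irr i rewrite irref G i = refl

record IsDRDF {n} (G : Graph n) (f : Fin n → ℕ) : Set where
  field
    range : ∀ v → f v ≤ 3
    zero-cond : ∀ v → f v ≡ 0 →
      (∃[ w ] (Adj G v w × f w ≡ 3)) ⊎
      (∃[ w₁ ] ∃[ w₂ ] (w₁ ≢ w₂ × Adj G v w₁ × Adj G v w₂ × f w₁ ≡ 2 × f w₂ ≡ 2))
    one-cond : ∀ v → f v ≡ 1 → ∃[ w ] (Adj G v w × f w ≥ 2)

weight : ∀ {n} → (Fin n → ℕ) → ℕ
weight {n} f = sum (map f (allFin n))

IsGammaDR : ∀ {n} → Graph n → ℕ → Set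
IsGammaDR G k =
  (Σ _ λ f → IsDRDF G f × weight f ≡ k) × (∀ f → IsDRDF G f → k ≤ weight f)

IncreasesGammaDR : ∀ {n} → Graph n → EdgeList n → Set
IncreasesGammaDR G B =
  ∀ k → IsGammaDR G k → ∀ f → IsDRDF (removeEdges G B) f → k < weight f

BondageAtMost : ∀ {n} → Graph n → ℕ → Set
BondageAtMost G m =
  Σ _ λ B → All (λ e → Adj G (Data.Product.proj₁ e) (Data.Product.proj₂ e)) B
          × length B ≤ m × IncreasesGammaDR G B

-- Let B consist of all edges at v and all edges at u except uw. In G − B the vertex v
-- is isolated and u is a leaf hanging from w, so every double Roman dominating function
-- f of G − B has f(v) ≥ 2 and f(u) + f(w) ≥ 2. Resetting u and v to 0 and w to 3 gives
-- a double Roman dominating function of G (u and v are now dominated by w, and every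
-- other vertex only sees values that did not decrease) of weight
-- w(f) − f(u) − f(v) − f(w) + 3 < w(f), while |B| ≤ deg(v) + deg(u) − 1.
module Submission where

open import Defs hiding (sym)
open import Data.Nat using (ℕ; suc; _+_; _∸_; _≤_; _<_; z≤n; s≤s; _≤?_)
open import Data.Nat.Properties hiding (_≟_)
open import Data.Bool using (Bool; true; false; _∧_; not; _∨_; if_then_else_)
open import Data.Bool.Properties using (T-≡; ∧-zeroʳ; ∨-zeroʳ)
open import Data.Fin using (Fin; zero; suc)
open import Data.Fin.Properties using (_≟_)
open import Data.List using (List; []; _∷_; map; length; _++_; filter; filterᵇ; allFin)
open import Data.List.Properties using (length-map; length-++; map-tabulate; filter-notAll)
open import Data.List.Membership.Propositional using (_∈_)
open import Data.List.Membership.Propositional.Properties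
  using (∈-allFin; ∈-map⁺; ∈-filter⁺; ∈-filter⁻; ∈-++⁺ˡ; ∈-++⁺ʳ)
open import Data.List.Relation.Unary.All as All using (All)
open import Data.List.Relation.Unary.All.Properties using (map⁺; ++⁺)
open import Data.List.Relation.Unary.Any as Any using (here; there)
open import Data.Nat.ListAction using (sum)
open import Data.Product using (_×_; _,_; ∃-syntax; proj₁; proj₂)
open import Data.Sum using (_⊎_; inj₁; inj₂)
open import Data.Vec.Functional using (updateAt)
open import Data.Vec.Functional.Properties using (updateAt-updates; updateAt-minimal)
open import Function using (_∘_; const; Equivalence)
open import Relation.Binary.PropositionalEquality
open import Relation.Nullary using (¬_; Dec; yes; no; contradiction)
open import Relation.Nullary.Decidable using (¬?; T?)
open import Algebra.Properties.CommutativeSemigroup +-commutativeSemigroup using (x∙yz≈y∙xz)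

private
  variable
    n : ℕ

length-filterᵇ : ∀ {A : Set} (p : A → Bool) xs →
  length (filterᵇ p xs) ≡ sum (map (λ x → if p x then 1 else 0) xs)
length-filterᵇ p [] = refl
length-filterᵇ p (x ∷ xs) with p x
... | true  = cong suc (length-filterᵇ p xs)
... | false = length-filterᵇ p xs

weight-suc : (h : Fin (suc n) → ℕ) → weight h ≡ h zero + weight (h ∘ suc)
weight-suc h = cong (λ l → h zero + sum l)
  (trans (map-tabulate suc h) (sym (map-tabulate (λ i → i) (h ∘ suc))))

weight-updateAt : (h : Fin n → ℕ) (p : Fin n) (c : ℕ) →
  h p + weight (updateAt h p (const c)) ≡ c + weight h
weight-updateAt {suc n} h zero c = begin
  h zero + weight (updateAt h zero (const c))
    ≡⟨ cong (h zero +_) (weight-suc (updateAt h zero (const c))) ⟩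
  h zero + (c + weight (h ∘ suc))
    ≡⟨ x∙yz≈y∙xz (h zero) c _ ⟩
  c + (h zero + weight (h ∘ suc))
    ≡⟨ cong (c +_) (weight-suc h) ⟨
  c + weight h
    ∎
  where open ≡-Reasoning
weight-updateAt {suc n} h (suc p) c = begin
  h (suc p) + weight (updateAt h (suc p) (const c))
    ≡⟨ cong (h (suc p) +_) (weight-suc (updateAt h (suc p) (const c))) ⟩
  h (suc p) + (h zero + weight (updateAt (h ∘ suc) p (const c)))
    ≡⟨ x∙yz≈y∙xz (h (suc p)) (h zero) _ ⟩
  h zero + (h (suc p) + weight (updateAt (h ∘ suc) p (const c)))
    ≡⟨ cong (h zero +_) (weight-updateAt (h ∘ suc) p c) ⟩
  h zero + (c + weight (h ∘ suc))
    ≡⟨ x∙yz≈y∙xz (h zero) c _ ⟩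
  c + (h zero + weight (h ∘ suc))
    ≡⟨ cong (c +_) (weight-suc h) ⟨
  c + weight h
    ∎
  where open ≡-Reasoning

_⊆ᴳ_ : Graph n → Graph n → Set
H ⊆ᴳ G = ∀ {x y} → Adj H x y → Adj G x y

Adj-sym : (G : Graph n) {x y : Fin n} → Adj G x y → Adj G y x
Adj-sym G {x} {y} xy = trans (sym (Graph.sym G x y)) xy

neighbours : Graph n → Fin n → List (Fin n)
neighbours {n} G x = filterᵇ (adj G x) (allFin n)

length-neighbours : (G : Graph n) (x : Fin n) → length (neighbours G x) ≡ deg G x
length-neighbours {n} G x = length-filterᵇ (adj G x) (allFin n)

∈-neighbours⁺ : (G : Graph n) {x y : Fin n} → Adj G x y → y ∈ neighbours G x
∈-neighbours⁺ G {x} {y} xy = ∈-filter⁺ (T? ∘ adj G x) (∈-allFin y) (Equivalence.from T-≡ xy)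

∈-neighbours⁻ : (G : Graph n) {x y : Fin n} → y ∈ neighbours G x → Adj G x y
∈-neighbours⁻ {n} G {x} y∈ =
  Equivalence.to T-≡ (proj₂ (∈-filter⁻ (T? ∘ adj G x) {xs = allFin n} y∈))

edgesAt : Fin n → List (Fin n) → EdgeList n
edgesAt x = map (x ,_)

edgesAt-⊆ : (G : Graph n) {x : Fin n} {ys : List (Fin n)} → (∀ {y} → y ∈ ys → Adj G x y) →
  All (λ e → Adj G (proj₁ e) (proj₂ e)) (edgesAt x ys)
edgesAt-⊆ G adjacent = map⁺ (All.tabulate adjacent)

inEdges-∈ : (B : EdgeList n) {a b : Fin n} → (a , b) ∈ B → inEdges B a b ≡ true
inEdges-∈ (_ ∷ _) {a} {b} (here refl) with a ≟ a | b ≟ b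
... | yes _   | yes _   = refl
... | no a≢a | _       = contradiction refl a≢a
... | _       | no b≢b = contradiction refl b≢b
inEdges-∈ (_ ∷ B) (there ab∈B) = trans (cong (_ ∨_) (inEdges-∈ B ab∈B)) (∨-zeroʳ _)

removeEdges-⊆ : (G : Graph n) (B : EdgeList n) → removeEdges G B ⊆ᴳ G
removeEdges-⊆ G B {x} {y} xy with adj G x y
... | true  = refl
... | false = xy

removeEdges-removes : (G : Graph n) (B : EdgeList n) {x y : Fin n} →
  (x , y) ∈ B → ¬ Adj (removeEdges G B) x y
removeEdges-removes G B {x} {y} xy∈B xy = contradiction (begin
  true                              ≡⟨ sym xy ⟩
  adj G x y ∧ not (inEdges B x y)  ≡⟨ cong (λ b → adj G x y ∧ not b) (inEdges-∈ B xy∈B) ⟩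
  adj G x y ∧ false                 ≡⟨ ∧-zeroʳ (adj G x y) ⟩
  false                             ∎) λ ()
  where open ≡-Reasoning

IsDRDF-heavyNeighbour : {H : Graph n} {f : Fin n → ℕ} → IsDRDF H f →
  ∀ {x} → f x ≤ 1 → ∃[ y ] Adj H x y × 2 ≤ f y
IsDRDF-heavyNeighbour {f = f} d {x} fx≤1 with f x in fx
... | 0 with IsDRDF.zero-cond d x fx
...   | inj₁ (y , xy , fy≡3) = y , xy , subst (2 ≤_) (sym fy≡3) (s≤s (s≤s z≤n))
...   | inj₂ (y , _ , _ , xy , _ , fy≡2 , _) = y , xy , ≤-reflexive (sym fy≡2)
IsDRDF-heavyNeighbour d {x} _ | 1 = IsDRDF.one-cond d x fx
IsDRDF-heavyNeighbour d (s≤s ()) | suc (suc _)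

IsDRDF-isolated : {H : Graph n} {f : Fin n → ℕ} → IsDRDF H f →
  ∀ {x} → (∀ y → ¬ Adj H x y) → 2 ≤ f x
IsDRDF-isolated {f = f} d {x} isolated with f x ≤? 1
... | yes fx≤1 = let y , xy , _ = IsDRDF-heavyNeighbour d fx≤1 in contradiction xy (isolated y)
... | no fx≰1  = ≰⇒> fx≰1

IsDRDF-pendant : {H : Graph n} {f : Fin n → ℕ} → IsDRDF H f →
  ∀ {x w} → (∀ y → Adj H x y → y ≡ w) → 2 ≤ f x + f w
IsDRDF-pendant {f = f} d {x} {w} pendant with f x ≤? 1
... | yes fx≤1 = let y , xy , 2≤fy = IsDRDF-heavyNeighbour d fx≤1 in
  ≤-trans (subst (λ z → 2 ≤ f z) (pendant y xy) 2≤fy) (m≤n+m (f w) (f x))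
... | no fx≰1  = ≤-trans (≰⇒> fx≰1) (m≤m+n (f x) (f w))

data Reassigned {n} (H G : Graph n) (f g : Fin n → ℕ) (x : Fin n) : Set where
  set-to-3       : g x ≡ 3 → Reassigned H G f g x
  dominated-by-3 : ∀ {y} → g x ≡ 0 → Adj G x y → g y ≡ 3 → Reassigned H G f g x
  unchanged      : g x ≡ f x → (∀ y → Adj H x y → f y ≤ g y) → Reassigned H G f g x

two-or-three : ∀ {m} → 2 ≤ m → m ≤ 3 → m ≡ 2 ⊎ m ≡ 3
two-or-three (s≤s (s≤s _)) (s≤s (s≤s z≤n))       = inj₁ refl
two-or-three (s≤s (s≤s _)) (s≤s (s≤s (s≤s z≤n))) = inj₂ refl

IsDRDF-transfer : {H G : Graph n} {f g : Fin n → ℕ} → H ⊆ᴳ G → IsDRDF H f →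
  (∀ x → Reassigned H G f g x) → IsDRDF G g
IsDRDF-transfer {G = G} {g = g} H⊆G d reassigned = record
  { range = range ; zero-cond = zero-cond ; one-cond = one-cond }
  where
  range : ∀ x → g x ≤ 3
  range x with reassigned x
  ... | set-to-3 gx≡3           = ≤-reflexive gx≡3
  ... | dominated-by-3 gx≡0 _ _ = subst (_≤ 3) (sym gx≡0) z≤n
  ... | unchanged gx≡fx _       = subst (_≤ 3) (sym gx≡fx) (IsDRDF.range d x)

  zero-cond : ∀ x → g x ≡ 0 →
    (∃[ y ] (Adj G x y × g y ≡ 3)) ⊎
    (∃[ y₁ ] ∃[ y₂ ] (y₁ ≢ y₂ × Adj G x y₁ × Adj G x y₂ × g y₁ ≡ 2 × g y₂ ≡ 2))
  zero-cond x gx≡0 with reassigned x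
  ... | set-to-3 gx≡3              = contradiction (trans (sym gx≡3) gx≡0) λ ()
  ... | dominated-by-3 _ xy gy≡3   = inj₁ (_ , xy , gy≡3)
  ... | unchanged gx≡fx monotone with IsDRDF.zero-cond d x (trans (sym gx≡fx) gx≡0)
  ...   | inj₁ (y , xy , fy≡3) =
          inj₁ (y , H⊆G xy , ≤-antisym (range y) (subst (_≤ g y) fy≡3 (monotone y xy)))
  ...   | inj₂ (y₁ , y₂ , y₁≢y₂ , xy₁ , xy₂ , fy₁≡2 , fy₂≡2)
          with two-or-three (subst (_≤ g y₁) fy₁≡2 (monotone y₁ xy₁)) (range y₁)
             | two-or-three (subst (_≤ g y₂) fy₂≡2 (monotone y₂ xy₂)) (range y₂)
  ...     | inj₂ gy₁≡3 | _          = inj₁ (y₁ , H⊆G xy₁ , gy₁≡3)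
  ...     | _          | inj₂ gy₂≡3 = inj₁ (y₂ , H⊆G xy₂ , gy₂≡3)
  ...     | inj₁ gy₁≡2 | inj₁ gy₂≡2 =
            inj₂ (y₁ , y₂ , y₁≢y₂ , H⊆G xy₁ , H⊆G xy₂ , gy₁≡2 , gy₂≡2)

  one-cond : ∀ x → g x ≡ 1 → ∃[ y ] (Adj G x y × 2 ≤ g y)
  one-cond x gx≡1 with reassigned x
  ... | set-to-3 gx≡3            = contradiction (trans (sym gx≡3) gx≡1) λ ()
  ... | dominated-by-3 _ xy gy≡3 = _ , xy , subst (2 ≤_) (sym gy≡3) (s≤s (s≤s z≤n))
  ... | unchanged gx≡fx monotone =
    let y , xy , 2≤fy = IsDRDF-heavyNeighbour d (≤-reflexive (trans (sym gx≡fx) gx≡1))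
    in y , H⊆G xy , ≤-trans 2≤fy (monotone y xy)

module PendantReassignment {n} {H G : Graph n} (H⊆G : H ⊆ᴳ G) {u w v : Fin n}
  (u≢w : u ≢ w) (w≢v : w ≢ v) (u≢v : u ≢ v) (uw : Adj G u w) (wv : Adj G w v)
  (v-isolated : ∀ y → ¬ Adj H v y) (u-pendant : ∀ y → Adj H u y → y ≡ w) where

  reassign : (Fin n → ℕ) → Fin n → ℕ
  reassign f = updateAt (updateAt (updateAt f u (const 0)) v (const 0)) w (const 3)

  module _ (f : Fin n → ℕ) where

    private
      f₁ f₂ : Fin n → ℕ
      f₁ = updateAt f u (const 0)
      f₂ = updateAt f₁ v (const 0)

    reassign-w : reassign f w ≡ 3
    reassign-w = updateAt-updates w f₂

    reassign-v : reassign f v ≡ 0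
    reassign-v = trans (updateAt-minimal v w f₂ (w≢v ∘ sym)) (updateAt-updates v f₁)

    reassign-u : reassign f u ≡ 0
    reassign-u = trans (updateAt-minimal u w f₂ u≢w)
                (trans (updateAt-minimal u v f₁ u≢v) (updateAt-updates u f))

    reassign-other : ∀ {x} → x ≢ u → x ≢ v → x ≢ w → reassign f x ≡ f x
    reassign-other x≢u x≢v x≢w = trans (updateAt-minimal _ w f₂ x≢w)
                                (trans (updateAt-minimal _ v f₁ x≢v) (updateAt-minimal _ u f x≢u))

    reassign-weight : f u + (f v + (f w + weight (reassign f))) ≡ 3 + weight f
    reassign-weight = begin
      f u + (f v + (f w + weight (reassign f)))
        ≡⟨ cong (λ t → f u + (f v + (t + weight (reassign f)))) f₂w≡fw ⟨
      f u + (f v + (f₂ w + weight (reassign f)))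
        ≡⟨ cong (λ t → f u + (f v + t)) (weight-updateAt f₂ w 3) ⟩
      f u + (f v + (3 + weight f₂))
        ≡⟨ cong (f u +_) (x∙yz≈y∙xz (f v) 3 _) ⟩
      f u + (3 + (f v + weight f₂))
        ≡⟨ cong (λ t → f u + (3 + (t + weight f₂))) f₁v≡fv ⟨
      f u + (3 + (f₁ v + weight f₂))
        ≡⟨ cong (λ t → f u + (3 + t)) (weight-updateAt f₁ v 0) ⟩
      f u + (3 + weight f₁)
        ≡⟨ x∙yz≈y∙xz (f u) 3 _ ⟩
      3 + (f u + weight f₁)
        ≡⟨ cong (3 +_) (weight-updateAt f u 0) ⟩
      3 + weight f
        ∎
      where
      open ≡-Reasoning
      f₁v≡fv : f₁ v ≡ f v
      f₁v≡fv = updateAt-minimal v u f (u≢v ∘ sym)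
      f₂w≡fw : f₂ w ≡ f w
      f₂w≡fw = trans (updateAt-minimal w v f₁ w≢v) (updateAt-minimal w u f (u≢w ∘ sym))

  reassign-Reassigned : ∀ {f} → (∀ x → f x ≤ 3) → ∀ x → Reassigned H G f (reassign f) x
  reassign-Reassigned {f} f≤3 x with x ≟ u | x ≟ v | x ≟ w
  ... | yes refl | _        | _        = dominated-by-3 (reassign-u f) uw (reassign-w f)
  ... | no _     | yes refl | _        = dominated-by-3 (reassign-v f) (Adj-sym G wv) (reassign-w f)
  ... | no _     | no _     | yes refl = set-to-3 (reassign-w f)
  ... | no x≢u   | no x≢v   | no x≢w   = unchanged (reassign-other f x≢u x≢v x≢w) untouched
    where
    untouched : ∀ y → Adj H x y → f y ≤ reassign f y
    untouched y xy with y ≟ w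
    ... | yes refl = subst (f w ≤_) (sym (reassign-w f)) (f≤3 w)
    ... | no y≢w   = ≤-reflexive (sym (reassign-other f y≢u y≢v y≢w))
      where
      y≢u : y ≢ u
      y≢u refl = x≢w (u-pendant x (Adj-sym H xy))
      y≢v : y ≢ v
      y≢v refl = v-isolated x (Adj-sym H xy)

  reassign-IsDRDF : ∀ {f} → IsDRDF H f → IsDRDF G (reassign f)
  reassign-IsDRDF d = IsDRDF-transfer H⊆G d (reassign-Reassigned (IsDRDF.range d))

  reassign-< : ∀ {f} → IsDRDF H f → weight (reassign f) < weight f
  reassign-< {f} d = +-cancelˡ-≤ 3 _ _ (begin
    4 + weight (reassign f)                   ≤⟨ +-monoˡ-≤ _ 4≤fu+fv+fw ⟩
    f u + (f v + f w) + weight (reassign f)   ≡⟨ +-assoc (f u) _ _ ⟩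
    f u + (f v + f w + weight (reassign f))   ≡⟨ cong (f u +_) (+-assoc (f v) _ _) ⟩
    f u + (f v + (f w + weight (reassign f))) ≡⟨ reassign-weight f ⟩
    3 + weight f                              ∎)
    where
    open ≤-Reasoning
    4≤fu+fv+fw : 4 ≤ f u + (f v + f w)
    4≤fu+fv+fw = subst (4 ≤_) (x∙yz≈y∙xz (f v) (f u) (f w))
      (+-mono-≤ (IsDRDF-isolated d v-isolated) (IsDRDF-pendant d u-pendant))

module _ (G : Graph n) (u w v : Fin n) where

  ≢w? : ∀ y → Dec (y ≢ w)
  ≢w? y = ¬? (y ≟ w)

  pathCut : EdgeList n
  pathCut = edgesAt u (filter ≢w? (neighbours G u)) ++ edgesAt v (neighbours G v)

  pathCut-⊆ : All (λ e → Adj G (proj₁ e) (proj₂ e)) pathCut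
  pathCut-⊆ = ++⁺ (edgesAt-⊆ G (∈-neighbours⁻ G ∘ proj₁ ∘ ∈-filter⁻ ≢w?))
                  (edgesAt-⊆ G (∈-neighbours⁻ G))

  pathCut-length : Adj G u w → length pathCut ≤ deg G u + deg G v ∸ 1
  pathCut-length uw = begin
    length pathCut                                  ≡⟨ length-++ (edgesAt u kept) ⟩
    length (edgesAt u kept) + length (edgesAt v (neighbours G v))
      ≡⟨ cong₂ _+_ (length-map (u ,_) kept) (length-map (v ,_) (neighbours G v)) ⟩
    length kept + length (neighbours G v)           ≡⟨ cong (length kept +_) (length-neighbours G v) ⟩
    length kept + deg G v                           ≤⟨ ∸-monoˡ-≤ 1 (+-monoˡ-< (deg G v) kept<deg) ⟩
    deg G u + deg G v ∸ 1                           ∎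
    where
    open ≤-Reasoning
    kept : List (Fin n)
    kept = filter ≢w? (neighbours G u)
    kept<deg : length kept < deg G u
    kept<deg = subst (length kept <_) (length-neighbours G u)
      (filter-notAll ≢w? (neighbours G u)
        (Any.map (λ { refl w≢w → w≢w refl }) (∈-neighbours⁺ G uw)))

  pathCut-isolates : ∀ y → ¬ Adj (removeEdges G pathCut) v y
  pathCut-isolates y vy = removeEdges-removes G pathCut
    (∈-++⁺ʳ _ (∈-map⁺ (v ,_) (∈-neighbours⁺ G (removeEdges-⊆ G pathCut vy)))) vy

  pathCut-pendant : ∀ y → Adj (removeEdges G pathCut) u y → y ≡ w
  pathCut-pendant y uy with y ≟ w
  ... | yes y≡w = y≡w
  ... | no y≢w  = contradiction uy (removeEdges-removes G pathCut
    (∈-++⁺ˡ (∈-map⁺ (u ,_) (∈-filter⁺ ≢w?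
      (∈-neighbours⁺ G (removeEdges-⊆ G pathCut uy)) y≢w))))

theorem3p7 : ∀ {n} (G : Graph n) → Connected G →
    (u w v : Fin n) → u ≢ w → w ≢ v → u ≢ v → Adj G u w → Adj G w v →
    BondageAtMost G (deg G u + deg G v ∸ 1)
theorem3p7 G _ u w v u≢w w≢v u≢v uw wv =
  pathCut G u w v , pathCut-⊆ G u w v , pathCut-length G u w v uw , increases
  where
  open PendantReassignment (removeEdges-⊆ G (pathCut G u w v)) u≢w w≢v u≢v uw wv
    (pathCut-isolates G u w v) (pathCut-pendant G u w v)
  increases : IncreasesGammaDR G (pathCut G u w v)
  increases k (_ , minimal) f f-drdf =
    ≤-<-trans (minimal (reassign f) (reassign-IsDRDF f-drdf)) (reassign-< f-drdf)
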